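{- Let $d\ge3$, $\mathcal A$, $\varphi$, $\mathbf u$, $\mathcal T$ and $f$ be as in the context. Let $(a,w,b)\in\mathcal T$. If $f(a,w,b)=(a',w',b')$, then $f(b,\overline w,a)=(b',\overline{w'},a')$.
   Context: $\mathcal A=\{0,\dots,d-1\}$; $\varphi(i)=0(i+1)$ for $0\le i\le d-2$, $\varphi(d-1)=0(d-1)(d-1)$; $\mathbf u$ is the fixed point of $\varphi$ starting with $0$ and $\mathcal L(\mathbf u)$ its set of finite factors. $\overline w$ denotes the mirror image (reversal) of $w$. A factor $w$ is bispecial if it has at least two left extensions ($a$ with $aw\in\mathcal L(\mathbf u)$) and at least two right extensions. Let $\mathcal T=\{(a,w,b): w\text{ bispecial factor of }\mathbf u,\ a,b\in\mathcal A,\ a,b<d-1,\ aw,wb\in\mathcal L(\mathbf u)\}$. For $(a,w,b)\in\mathcal T$ define $f(a,w,b)=(a',w',b')$ with $a'=(a+1)\bmod (d-1)$, $b'=(b+1)\bmod(d-1)$ (residues in $\{0,\dots,d-2\}$) and $w'=\varphi(w)0$ if $a<d-2,b<d-2$; $w'=\varphi(w)0(d-1)$ if $a<d-2,b=d-2$; $w'=(d-1)\varphi(w)0$ if $a=d-2,b<d-2$; $w'=(d-1)\varphi(w)0(d-1)$ if $a=b=d-2$. -}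

module Defs where

open import Data.Nat using (ℕ; zero; suc; _+_; _∸_; _<_; _%_; _<?_)
open import Data.Nat.Properties using (_≟_)
open import Data.List using (List; []; _∷_; _++_; concatMap; map; length; upTo; _∷ʳ_)
open import Data.Product using (Σ; _×_; _,_)
open import Relation.Binary.PropositionalEquality using (_≡_; _≢_)
open import Relation.Nullary.Decidable using (⌊_⌋)
open import Data.Bool using (if_then_else_)
open import Function using (_∘_)

Word : Set
Word = List ℕ

-- The substitution φ : i ↦ 0(i+1) for i ≤ d-2, (d-1) ↦ 0(d-1)(d-1).
-- (Letters ≥ d never occur in 𝐮; they are sent to the same image as d-1.)
φ : ℕ → ℕ → Word
φ d i = if ⌊ suc i <? d ⌋ then 0 ∷ suc i ∷ [] else 0 ∷ (d ∸ 1) ∷ (d ∸ 1) ∷ []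

φ* : ℕ → Word → Word
φ* d = concatMap (φ d)

iterφ : ℕ → ℕ → Word
iterφ d zero    = 0 ∷ []
iterφ d (suc n) = φ* d (iterφ d n)

-- list lookup with a default value 0 (only used in range).
lookupD : Word → ℕ → ℕ
lookupD []       _       = 0
lookupD (x ∷ xs) zero    = x
lookupD (x ∷ xs) (suc i) = lookupD xs i

-- The fixed point 𝐮 = lim φⁿ(0): its i-th letter is the i-th letter of
-- φ^(i+1)(0), which has length ≥ i+2 and is a prefix of 𝐮.
u : ℕ → ℕ → ℕ
u d i = lookupD (iterφ d (suc i)) i

slice : ℕ → ℕ → ℕ → Word
slice d i n = map (λ j → u d (i + j)) (upTo n)

Factor : ℕ → Word → Set
Factor d w = Σ ℕ λ i → w ≡ slice d i (length w)

Bispecial : ℕ → Word → Set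
Bispecial d w =
  (Σ ℕ λ a₁ → Σ ℕ λ a₂ → a₁ ≢ a₂ × Factor d (a₁ ∷ w) × Factor d (a₂ ∷ w)) ×
  (Σ ℕ λ b₁ → Σ ℕ λ b₂ → b₁ ≢ b₂ × Factor d (w ∷ʳ b₁) × Factor d (w ∷ʳ b₂))

InT : ℕ → ℕ → Word → ℕ → Set
InT d a w b = Bispecial d w × a < d ∸ 1 × b < d ∸ 1 × Factor d (a ∷ w) × Factor d (w ∷ʳ b)

-- (x) mod (d-1); for d ≥ 2 we have suc (d ∸ 2) = d - 1.
modD : ℕ → ℕ → ℕ
modD d x = x % suc (d ∸ 2)

f : ℕ → ℕ → Word → ℕ → ℕ × Word × ℕ
f d a w b = modD d (suc a) , w' , modD d (suc b)
  where
    core : Word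
    core = φ* d w ++ 0 ∷ []
    left : Word → Word
    left x = if ⌊ a ≟ d ∸ 2 ⌋ then (d ∸ 1) ∷ x else x
    right : Word → Word
    right x = if ⌊ b ≟ d ∸ 2 ⌋ then x ∷ʳ (d ∸ 1) else x
    w' : Word
    w' = left (right core)

{-# OPTIONS --safe #-}
-- Every φ-image is 0 followed by a palindrome (0·(i+1) and 0·(d-1)(d-1)), so
-- φ(x)0 = 0·reverse(φ(x)) letter by letter, and hence reverse(φ(w)0) = φ(reverse w)0.
-- The letters d-1 attached on the left (when a = d-2) and on the right
-- (when b = d-2) trade places under reversal exactly as a and b do.
module Submission where

open import Defs
open import Data.Nat using (ℕ; _≤_; suc; _∸_; _<?_)
open import Data.Nat.Properties using (_≟_)
open import Data.Bool using (Bool; true; false; if_then_else_)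
open import Data.List using (List; []; _∷_; _++_; _∷ʳ_; reverse; concatMap)
open import Data.List.Properties
  using (reverse-++; unfold-reverse; concatMap-++; ++-assoc; ++-identityʳ)
open import Data.Product using (_,_)
open import Relation.Nullary.Decidable using (⌊_⌋)
open import Relation.Binary.PropositionalEquality
  using (_≡_; refl; sym; trans; cong; module ≡-Reasoning)
open import Level using (Level)
open ≡-Reasoning

private
  variable
    ℓ : Level
    A : Set ℓ

concatMap-reverse-∷ʳ : {A : Set ℓ} (g : A → List A) (c : A) →
                       (∀ x → g x ∷ʳ c ≡ c ∷ reverse (g x)) →
                       ∀ w → concatMap g (reverse w) ∷ʳ c ≡ c ∷ reverse (concatMap g w)
concatMap-reverse-∷ʳ g c g-conj [] = refl
concatMap-reverse-∷ʳ {A = A} g c g-conj (x ∷ xs) = begin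
  concatMap g (reverse (x ∷ xs)) ∷ʳ c
    ≡⟨ cong (λ v → concatMap g v ∷ʳ c) (unfold-reverse x xs) ⟩
  concatMap g (reverse xs ∷ʳ x) ∷ʳ c
    ≡⟨ cong (_∷ʳ c) (concatMap-++ g (reverse xs) (x ∷ [])) ⟩
  (prefix ++ (g x ++ [])) ∷ʳ c
    ≡⟨ cong (λ v → (prefix ++ v) ∷ʳ c) (++-identityʳ (g x)) ⟩
  (prefix ++ g x) ∷ʳ c
    ≡⟨ ++-assoc prefix (g x) (c ∷ []) ⟩
  prefix ++ (g x ∷ʳ c)
    ≡⟨ cong (prefix ++_) (g-conj x) ⟩
  prefix ++ c ∷ reverse (g x)
    ≡⟨ sym (++-assoc prefix (c ∷ []) (reverse (g x))) ⟩
  (prefix ∷ʳ c) ++ reverse (g x)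
    ≡⟨ cong (_++ reverse (g x)) (concatMap-reverse-∷ʳ g c g-conj xs) ⟩
  c ∷ reverse (concatMap g xs) ++ reverse (g x)
    ≡⟨ cong (c ∷_) (sym (reverse-++ (g x) (concatMap g xs))) ⟩
  c ∷ reverse (concatMap g (x ∷ xs)) ∎
  where
    prefix : List A
    prefix = concatMap g (reverse xs)

consIf : Bool → A → List A → List A
consIf p c xs = if p then c ∷ xs else xs

snocIf : Bool → A → List A → List A
snocIf p c xs = if p then xs ∷ʳ c else xs

reverse-consIf-snocIf : ∀ p q (c : A) xs →
  reverse (consIf p c (snocIf q c xs)) ≡ consIf q c (snocIf p c (reverse xs))
reverse-consIf-snocIf false false c xs = refl
reverse-consIf-snocIf false true  c xs = reverse-++ xs (c ∷ [])
reverse-consIf-snocIf true  false c xs = unfold-reverse c xs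
reverse-consIf-snocIf true  true  c xs =
  trans (unfold-reverse c (xs ∷ʳ c)) (cong (_∷ʳ c) (reverse-++ xs (c ∷ [])))

φ-∷ʳ-0 : ∀ d x → φ d x ∷ʳ 0 ≡ 0 ∷ reverse (φ d x)
φ-∷ʳ-0 d x with ⌊ suc x <? d ⌋
... | true  = refl
... | false = refl

φ*-reverse-∷ʳ-0 : ∀ d w → φ* d (reverse w) ∷ʳ 0 ≡ reverse (φ* d w ∷ʳ 0)
φ*-reverse-∷ʳ-0 d w =
  trans (concatMap-reverse-∷ʳ (φ d) 0 (φ-∷ʳ-0 d) w) (sym (reverse-++ (φ* d w) (0 ∷ [])))

lemma10 : (d : ℕ) → 3 ≤ d → (a b : ℕ) (w : Word) → InT d a w b →
    (a' b' : ℕ) (w' : Word) → f d a w b ≡ (a' , w' , b') →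
    f d b (reverse w) a ≡ (b' , reverse w' , a')
lemma10 d _ a b w _ ._ ._ ._ refl = cong (λ v → modD d (suc b) , v , modD d (suc a)) (begin
  consIf b? (d ∸ 1) (snocIf a? (d ∸ 1) (φ* d (reverse w) ∷ʳ 0))
    ≡⟨ cong (λ v → consIf b? (d ∸ 1) (snocIf a? (d ∸ 1) v)) (φ*-reverse-∷ʳ-0 d w) ⟩
  consIf b? (d ∸ 1) (snocIf a? (d ∸ 1) (reverse (φ* d w ∷ʳ 0)))
    ≡⟨ sym (reverse-consIf-snocIf a? b? (d ∸ 1) (φ* d w ∷ʳ 0)) ⟩
  reverse (consIf a? (d ∸ 1) (snocIf b? (d ∸ 1) (φ* d w ∷ʳ 0))) ∎)
  where
    a? b? : Bool
    a? = ⌊ a ≟ d ∸ 2 ⌋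
    b? = ⌊ b ≟ d ∸ 2 ⌋
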